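{- Let $k\in\mathbb{N}$ and let $\mathcal{F}_k$ be the set of minimal excluded minors for the class of finite undirected graphs of entanglement at most $k$, i.e. the graphs $F$ with $\operatorname{ent}(F)>k$ such that every proper minor of $F$ has entanglement at most $k$. Then every graph in $\mathcal{F}_k$ has entanglement exactly $k+1$.
   Context: For a finite undirected graph $G$ and $k \in \{0,\dots,|V_G|\}$, the entanglement game $\mathcal{E}(G,k)$ is played by Robber against a team of $k$ cops. Positions are triples $(v,C,P)$ with $v\in V_G$, $C\subseteq V_G$ with $|C|\le k$, and $P\in\{\text{Cops},\text{Robber}\}$. Initially Robber chooses any $v_0\in V_G$, giving position $(v_0,\emptyset,\text{Cops})$. From $(v,C,\text{Cops})$ Cops move to $(v,C',\text{Robber})$ where $C'$ is either $C$, $C\cup\{v\}$, or $(C\setminus\{x\})\cup\{v\}$ for some $x\in C$. From $(v,C,\text{Robber})$ Robber must move to $(v',C,\text{Cops})$ where $v'$ is adjacent to $v$ and $v'\notin C$; if no such $v'$ exists Robber is caught. Every finite play is a win for Cops, every infinite play a win for Robber. The entanglement $\operatorname{ent}(G)$ is the minimum $k$ such that Cops have a winning strategy in $\mathcal{E}(G,k)$. A graph $G$ is a minor of $H$ if $G$ can be obtained from $H$ by successive edge deletions, edge contractions (the end-vertices of the edge are replaced by one new vertex adjacent to all their neighbors) and deletions of isolated vertices; a proper minor is a minor different from the graph itself. -}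

module Defs where

open import Data.Nat using (ℕ; _≤_; _<_)
open import Data.Bool using (Bool; true; false)
open import Data.Fin using (Fin)
open import Data.Fin.Subset using (Subset; ⊥; ⁅_⁆; _∈_; _∉_; _∪_; _─_; ∣_∣)
open import Data.Product using (Σ; _×_; ∃; ∃-syntax)
open import Data.Sum using (_⊎_)
open import Relation.Nullary using (¬_)
open import Relation.Binary.PropositionalEquality using (_≡_; _≢_)
open import Relation.Binary.Construct.Closure.Transitive using (TransClosure)

record Graph : Set where
  field
    n      : ℕ
    adj    : Fin n → Fin n → Bool
    sym    : ∀ x y → adj x y ≡ adj y x
    irrefl : ∀ x → adj x x ≡ false

open Graph public

Adj : (G : Graph) → Fin (n G) → Fin (n G) → Set
Adj G x y = adj G x y ≡ true

_↔_ : Set → Set → Set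
A ↔ B = (A → B) × (B → A)

SamePair : ∀ {m} → Fin m → Fin m → Fin m → Fin m → Set
SamePair u v x y = (x ≡ u × y ≡ v) ⊎ (x ≡ v × y ≡ u)

module Game (G : Graph) (k : ℕ) where

  data CopsMove (v : Fin (n G)) (C : Subset (n G)) : Subset (n G) → Set where
    stay : CopsMove v C C
    add  : CopsMove v C (C ∪ ⁅ v ⁆)
    swap : ∀ x → x ∈ C → CopsMove v C ((C ─ ⁅ x ⁆) ∪ ⁅ v ⁆)

  -- Cops have a winning strategy from the Cops-position (v , C , Cops):
  -- the (well-founded) strategy tree, every play consistent with it is finite.
  data CopsWin : Fin (n G) → Subset (n G) → Set where
    win : ∀ {v C} (C' : Subset (n G)) → CopsMove v C C' → ∣ C' ∣ ≤ k →
          (∀ v' → Adj G v v' → v' ∉ C' → CopsWin v' C') →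
          CopsWin v C

CopsWinGame : Graph → ℕ → Set
CopsWinGame G k = ∀ v₀ → Game.CopsWin G k v₀ ⊥

EntIs : Graph → ℕ → Set
EntIs G m = CopsWinGame G m × (∀ j → j < m → ¬ CopsWinGame G j)

EntAtMost : Graph → ℕ → Set
EntAtMost G k = ∃[ j ] (j ≤ k × CopsWinGame G j)

EntGreater : Graph → ℕ → Set
EntGreater G k = ∀ j → j ≤ k → ¬ CopsWinGame G j

record EdgeDeletion (G H : Graph) : Set where
  field
    u v  : Fin (n G)
    uv   : Adj G u v
    φ    : Fin (n G) → Fin (n H)
    φ-inj  : ∀ x y → φ x ≡ φ y → x ≡ y
    φ-surj : ∀ a → ∃[ x ] φ x ≡ a
    φ-adj  : ∀ x y → Adj H (φ x) (φ y) ↔ (Adj G x y × ¬ SamePair u v x y)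

record EdgeContraction (G H : Graph) : Set where
  field
    u v  : Fin (n G)
    uv   : Adj G u v
    f    : Fin (n G) → Fin (n H)
    f-ker  : ∀ x y → (f x ≡ f y) ↔ (x ≡ y ⊎ SamePair u v x y)
    f-surj : ∀ a → ∃[ x ] f x ≡ a
    f-adj  : ∀ a b → Adj H a b ↔
               (a ≢ b × ∃[ x ] ∃[ y ] (f x ≡ a × f y ≡ b × Adj G x y))

record IsolatedVertexDeletion (G H : Graph) : Set where
  field
    w     : Fin (n G)
    w-iso : ∀ y → adj G w y ≡ false
    g     : Fin (n H) → Fin (n G)
    g-inj  : ∀ a b → g a ≡ g b → a ≡ b
    g-miss : ∀ a → g a ≢ w
    g-onto : ∀ x → x ≢ w → ∃[ a ] g a ≡ x
    g-adj  : ∀ a b → adj H a b ≡ adj G (g a) (g b)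

data MinorStep (G H : Graph) : Set where
  delete-edge     : EdgeDeletion G H → MinorStep G H
  contract-edge   : EdgeContraction G H → MinorStep G H
  delete-isolated : IsolatedVertexDeletion G H → MinorStep G H

ProperMinor : Graph → Graph → Set
ProperMinor G H = TransClosure MinorStep G H

InFk : ℕ → Graph → Set
InFk k F = EntGreater F k × (∀ H → ProperMinor F H → EntAtMost H k)

-- If ent(F) > k, F has an edge uv, and by minimality F − uv is won by j ≤ k cops.
-- One extra cop then suffices on F: the cops follow the strategy for F − uv, and
-- once Robber stands on an endpoint p of uv the extra cop sits on p for good.
-- Robber can use the missing edge at most once, right after reaching p; the cops
-- then restart the strategy for F − uv with p still guarded. Hence
-- ent(F) ≤ j + 1 ≤ k + 1.
module Submission where

open import Defs
open import Data.Bool using (true; false; not; _∧_)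
open import Data.Bool.Properties using () renaming (_≟_ to _≟ᵇ_)
open import Data.Fin using (Fin; _≟_)
open import Data.Fin.Properties using (any?)
open import Data.Fin.Subset using (Subset; ⊥; ⁅_⁆; _∈_; _∉_; _∪_; _-_; _⊆_; ∣_∣; inside; outside)
open import Data.Fin.Subset.Properties
open import Data.Nat using (ℕ; suc; _≤_; _<_; _+_; z≤n; s≤s)
open import Data.Nat.Properties
  using (≤-trans; ≤-reflexive; ≤-pred; <⇒≱; ≮⇒≥; <-≤-trans; +-suc; +-comm; +-monoʳ-≤; module ≤-Reasoning)
  renaming (_≤?_ to _≤ℕ?_)
open import Data.Product using (∃; _×_; _,_; proj₁; proj₂)
open import Data.Sum as Sum using (_⊎_; inj₁; inj₂; [_,_])
open import Data.Vec using (_∷_; [])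
open import Function using (_∘_)
open import Function.Bundles using (mk⇔)
open import Relation.Nullary using (¬_; Dec; yes; no; does; ¬?; _×-dec_; _⊎-dec_; contradiction)
open import Relation.Nullary.Decidable using (decidable-stable; does-⇔)
open import Relation.Binary.PropositionalEquality as ≡ using (_≡_; _≢_; refl; cong; cong₂; subst)
open import Relation.Binary.Construct.Closure.Transitive using () renaming ([_] to single)

∣p∪q∣≤∣p∣+∣q∣ : ∀ {m} (p q : Subset m) → ∣ p ∪ q ∣ ≤ ∣ p ∣ + ∣ q ∣
∣p∪q∣≤∣p∣+∣q∣ []            []            = z≤n
∣p∪q∣≤∣p∣+∣q∣ (outside ∷ p) (outside ∷ q) = ∣p∪q∣≤∣p∣+∣q∣ p q
∣p∪q∣≤∣p∣+∣q∣ (outside ∷ p) (inside  ∷ q) =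
  ≤-trans (s≤s (∣p∪q∣≤∣p∣+∣q∣ p q)) (≤-reflexive (≡.sym (+-suc ∣ p ∣ ∣ q ∣)))
∣p∪q∣≤∣p∣+∣q∣ (inside  ∷ p) (s       ∷ q) =
  s≤s (≤-trans (∣p∪q∣≤∣p∣+∣q∣ p q) (+-monoʳ-≤ ∣ p ∣ (∣p∣≤∣x∷p∣ s q)))

∣p∪⁅x⁆∣≤1+∣p∣ : ∀ {m} (p : Subset m) x → ∣ p ∪ ⁅ x ⁆ ∣ ≤ suc ∣ p ∣
∣p∪⁅x⁆∣≤1+∣p∣ p x = begin
  ∣ p ∪ ⁅ x ⁆ ∣     ≤⟨ ∣p∪q∣≤∣p∣+∣q∣ p ⁅ x ⁆ ⟩
  ∣ p ∣ + ∣ ⁅ x ⁆ ∣ ≡⟨ cong (∣ p ∣ +_) (∣⁅x⁆∣≡1 x) ⟩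
  ∣ p ∣ + 1         ≡⟨ +-comm ∣ p ∣ 1 ⟩
  suc ∣ p ∣         ∎
  where open ≤-Reasoning

∣p∣<∣q∣⇒∃x∈q∉p : ∀ {m} (p q : Subset m) → ∣ p ∣ < ∣ q ∣ → ∃ λ x → x ∈ q × x ∉ p
∣p∣<∣q∣⇒∃x∈q∉p p q ∣p∣<∣q∣ with any? (λ x → x ∈? q ×-dec ¬? (x ∈? p))
... | yes witness = witness
... | no none     = contradiction (p⊆q⇒∣p∣≤∣q∣ q⊆p) (<⇒≱ ∣p∣<∣q∣)
  where
  q⊆p : q ⊆ p
  q⊆p {x} x∈q = decidable-stable (x ∈? p) (λ x∉p → none (x , x∈q , x∉p))

∪-lub : ∀ {m} {p q r : Subset m} → p ⊆ r → q ⊆ r → p ∪ q ⊆ r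
∪-lub {p = p} {q} p⊆r q⊆r x∈p∪q = [ p⊆r , q⊆r ] (x∈p∪q⁻ p q x∈p∪q)

⁅x⁆⊆p : ∀ {m} {x : Fin m} {p} → x ∈ p → ⁅ x ⁆ ⊆ p
⁅x⁆⊆p {x = x} {p} x∈p y∈⁅x⁆ = subst (_∈ p) (≡.sym (x∈⁅y⁆⇒x≡y x y∈⁅x⁆)) x∈p

x∈p∪⁅x⁆ : ∀ {m} (p : Subset m) x → x ∈ p ∪ ⁅ x ⁆
x∈p∪⁅x⁆ p x = q⊆p∪q p ⁅ x ⁆ (x∈⁅x⁆ x)

x∈p∪⁅y⁆⁻ : ∀ {m} {x : Fin m} (p : Subset m) y → x ∈ p ∪ ⁅ y ⁆ → x ∈ p ⊎ x ≡ y
x∈p∪⁅y⁆⁻ p y = Sum.map₂ (x∈⁅y⁆⇒x≡y y) ∘ x∈p∪q⁻ p ⁅ y ⁆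

x∈p∧y∉p⇒y≢x : ∀ {m} {x y : Fin m} {p} → x ∈ p → y ∉ p → y ≢ x
x∈p∧y∉p⇒y≢x x∈p y∉p refl = y∉p x∈p

p⊆q∪⁅x⁆⇒p⊆q : ∀ {m} {p q : Subset m} {x} → p ⊆ q ∪ ⁅ x ⁆ → (x ∈ p → x ∈ q) → p ⊆ q
p⊆q∪⁅x⁆⇒p⊆q {q = q} {x} p⊆q∪x x∈q y∈p with x∈p∪⁅y⁆⁻ q x (p⊆q∪x y∈p)
... | inj₁ y∈q = y∈q
... | inj₂ refl = x∈q y∈p

module _ (G : Graph) (m : ℕ) where
  open Game G m

  CopsMove-⊆ : ∀ {x C C'} → CopsMove x C C' → C' ⊆ C ∪ ⁅ x ⁆
  CopsMove-⊆ {x} stay     = p⊆p∪q ⁅ x ⁆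
  CopsMove-⊆     add      = λ h → h
  CopsMove-⊆ {x} {C} (swap z _) = ∪-lub (⊆-trans (p─q⊆p C ⁅ z ⁆) (p⊆p∪q ⁅ x ⁆)) (q⊆p∪q C ⁅ x ⁆)

  record MoveOnto (x : Fin (n G)) (D T : Subset (n G)) : Set where
    constructor moveOnto
    field
      next  : Subset (n G)
      move  : CopsMove x D next
      cover : T ⊆ next
      bound : ∣ next ∣ ≤ m

  canMoveOnto : ∀ {x D T} → T ⊆ D ∪ ⁅ x ⁆ → ∣ T ∣ ≤ m → ∣ D ∣ ≤ m → MoveOnto x D T
  canMoveOnto {x} {D} {T} T⊆D∪x ∣T∣≤m ∣D∣≤m with x ∈? D | x ∈? T
  ... | yes x∈D | _      = moveOnto D stay (p⊆q∪⁅x⁆⇒p⊆q T⊆D∪x (λ _ → x∈D)) ∣D∣≤m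
  ... | no _    | no x∉T = moveOnto D stay (p⊆q∪⁅x⁆⇒p⊆q T⊆D∪x (λ x∈T → contradiction x∈T x∉T)) ∣D∣≤m
  ... | no _    | yes x∈T with suc ∣ D ∣ ≤ℕ? m
  ...   | yes ∣D∣<m = moveOnto (D ∪ ⁅ x ⁆) add T⊆D∪x (≤-trans (∣p∪⁅x⁆∣≤1+∣p∣ D x) ∣D∣<m)
  ...   | no  ∣D∣≮m
    with ∣p∣<∣q∣⇒∃x∈q∉p (T - x) D (<-≤-trans (x∈p⇒∣p-x∣<∣p∣ x∈T) (≤-trans ∣T∣≤m (≮⇒≥ ∣D∣≮m)))
  ...   | z , z∈D , z∉T-x = moveOnto ((D - z) ∪ ⁅ x ⁆) (swap z z∈D) T⊆D-z∪x ∣D-z∪x∣≤m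
    where
    T⊆D-z∪x : T ⊆ (D - z) ∪ ⁅ x ⁆
    T⊆D-z∪x {t} t∈T with t ≟ x | x∈p∪⁅y⁆⁻ D x (T⊆D∪x t∈T)
    ... | yes refl | _         = x∈p∪⁅x⁆ (D - z) x
    ... | no t≢x   | inj₂ t≡x  = contradiction t≡x t≢x
    ... | no t≢x   | inj₁ t∈D  = p⊆p∪q ⁅ x ⁆ (x∈p∧x≢y⇒x∈p-y t∈D t≢z)
      where
      t≢z : t ≢ z
      t≢z refl = z∉T-x (x∈p∧x≢y⇒x∈p-y t∈T t≢x)
    ∣D-z∪x∣≤m : ∣ (D - z) ∪ ⁅ x ⁆ ∣ ≤ m
    ∣D-z∪x∣≤m = ≤-trans (∣p∪⁅x⁆∣≤1+∣p∣ (D - z) x) (≤-trans (x∈p⇒∣p-x∣<∣p∣ z∈D) ∣D∣≤m)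

module _ (G : Graph) where

  CopsWin-mono : ∀ {a b x C} → a ≤ b → Game.CopsWin G a x C → Game.CopsWin G b x C
  CopsWin-mono {a} {b} a≤b (Game.win C' mv ∣C'∣≤a next) =
    Game.win C' (relabel mv) (≤-trans ∣C'∣≤a a≤b) (λ y xy y∉C' → CopsWin-mono a≤b (next y xy y∉C'))
    where
    relabel : ∀ {x C C'} → Game.CopsMove G a x C C' → Game.CopsMove G b x C C'
    relabel Game.stay       = Game.stay
    relabel Game.add        = Game.add
    relabel (Game.swap z h) = Game.swap z h

  CopsWinGame-mono : ∀ {a b} → a ≤ b → CopsWinGame G a → CopsWinGame G b
  CopsWinGame-mono a≤b win v₀ = CopsWin-mono a≤b (win v₀)

  edgeless⇒CopsWinGame-0 : (∀ x y → ¬ Adj G x y) → CopsWinGame G 0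
  edgeless⇒CopsWinGame-0 noEdge v₀ =
    Game.win ⊥ Game.stay (≤-reflexive (∣⊥∣≡0 (n G))) (λ y v₀y _ → contradiction v₀y (noEdge v₀ y))

  edge? : Dec (∃ λ x → ∃ λ y → Adj G x y)
  edge? = any? λ x → any? λ y → adj G x y ≟ᵇ true

∧-not-does≡true : ∀ {P : Set} b (P? : Dec P) → (b ∧ not (does P?) ≡ true) ↔ (b ≡ true × ¬ P)
∧-not-does≡true true  (yes p) = (λ ()) , λ (_ , ¬p) → contradiction p ¬p
∧-not-does≡true true  (no ¬p) = (λ _ → refl , ¬p) , λ _ → refl
∧-not-does≡true false _       = (λ ()) , λ { (() , _) }

SamePair-sym : ∀ {m} {u v x y : Fin m} → SamePair u v x y → SamePair u v y x
SamePair-sym (inj₁ (x≡u , y≡v)) = inj₂ (y≡v , x≡u)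
SamePair-sym (inj₂ (x≡v , y≡u)) = inj₁ (y≡u , x≡v)

SamePair⇒endpoint : ∀ {m} {u v x y : Fin m} → SamePair u v x y → x ≡ u ⊎ x ≡ v
SamePair⇒endpoint = Sum.map proj₁ proj₁

SamePair-meets-endpoint : ∀ {m} {u v x y p : Fin m} → SamePair u v x y → p ≡ u ⊎ p ≡ v → p ≡ x ⊎ p ≡ y
SamePair-meets-endpoint (inj₁ (refl , refl)) (inj₁ refl) = inj₁ refl
SamePair-meets-endpoint (inj₁ (refl , refl)) (inj₂ refl) = inj₂ refl
SamePair-meets-endpoint (inj₂ (refl , refl)) (inj₁ refl) = inj₂ refl
SamePair-meets-endpoint (inj₂ (refl , refl)) (inj₂ refl) = inj₁ refl

module _ (G : Graph) (u v : Fin (n G)) where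

  SamePair? : ∀ x y → Dec (SamePair u v x y)
  SamePair? x y = ((x ≟ u) ×-dec (y ≟ v)) ⊎-dec ((x ≟ v) ×-dec (y ≟ u))

  removeEdge : Graph
  removeEdge = record
    { n      = n G
    ; adj    = λ x y → adj G x y ∧ not (does (SamePair? x y))
    ; sym    = λ x y → cong₂ _∧_ (sym G x y)
                 (cong not (does-⇔ (mk⇔ SamePair-sym SamePair-sym) (SamePair? x y) (SamePair? y x)))
    ; irrefl = λ x → cong (_∧ _) (irrefl G x)
    }

  Adj-removeEdge : ∀ x y → Adj removeEdge x y ↔ (Adj G x y × ¬ SamePair u v x y)
  Adj-removeEdge x y = ∧-not-does≡true (adj G x y) (SamePair? x y)

  Adj-removeEdge⁺ : ∀ {x y} → Adj G x y → ¬ SamePair u v x y → Adj removeEdge x y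
  Adj-removeEdge⁺ {x} {y} xy xy≢uv = proj₂ (Adj-removeEdge x y) (xy , xy≢uv)

  removeEdge-isEdgeDeletion : Adj G u v → EdgeDeletion G removeEdge
  removeEdge-isEdgeDeletion uv = record
    { u = u ; v = v ; uv = uv
    ; φ = λ x → x ; φ-inj = λ _ _ x≡y → x≡y ; φ-surj = λ x → x , refl
    ; φ-adj = Adj-removeEdge
    }

module _ (G : Graph) (u v : Fin (n G)) {j : ℕ} (win : CopsWinGame (removeEdge G u v) j) where
  private
    module H = Game (removeEdge G u v) j
    module F = Game G (suc j)

    follow : ∀ {x C C' D} q → H.CopsMove x C C' → ∣ C' ∣ ≤ j → C ⊆ D → q ∈ D ∪ ⁅ x ⁆ → ∣ D ∣ ≤ suc j →
             MoveOnto G (suc j) x D (C' ∪ ⁅ q ⁆)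
    follow {x} {C' = C'} {D} q mv ∣C'∣≤j C⊆D q∈D∪x ∣D∣≤1+j =
      canMoveOnto G (suc j) (∪-lub C'⊆D∪x (⁅x⁆⊆p q∈D∪x))
        (≤-trans (∣p∪⁅x⁆∣≤1+∣p∣ C' q) (s≤s ∣C'∣≤j)) ∣D∣≤1+j
      where
      C'⊆D∪x : C' ⊆ D ∪ ⁅ x ⁆
      C'⊆D∪x = ⊆-trans (CopsMove-⊆ (removeEdge G u v) j mv) (∪-lub (⊆-trans C⊆D (p⊆p∪q _)) (q⊆p∪q _ _))

    -- Once Robber has left the guarded endpoint p, he can never cross the deleted edge.
    guarded : ∀ {x C D} p → p ≡ u ⊎ p ≡ v → p ∈ D → x ≢ p → H.CopsWin x C → C ⊆ D → ∣ D ∣ ≤ suc j →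
              F.CopsWin x D
    guarded {x} p p-end p∈D x≢p (H.win C' mv ∣C'∣≤j next) C⊆D ∣D∣≤1+j
      with follow p mv ∣C'∣≤j C⊆D (p⊆p∪q _ p∈D) ∣D∣≤1+j
    ... | moveOnto D' mv' cover ∣D'∣≤1+j = F.win D' mv' ∣D'∣≤1+j respond
      where
      C'⊆D' : C' ⊆ D'
      C'⊆D' = cover ∘ p⊆p∪q _
      p∈D' : p ∈ D'
      p∈D' = cover (x∈p∪⁅x⁆ _ p)
      respond : ∀ y → Adj G x y → y ∉ D' → F.CopsWin y D'
      respond y xy y∉D' =
        guarded p p-end p∈D' y≢p (next y (Adj-removeEdge⁺ G u v xy xy≢uv) (y∉D' ∘ C'⊆D')) C'⊆D' ∣D'∣≤1+j
        where
        y≢p : y ≢ p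
        y≢p = x∈p∧y∉p⇒y≢x p∈D' y∉D'
        xy≢uv : ¬ SamePair u v x y
        xy≢uv xy≡uv = [ x≢p ∘ ≡.sym , y≢p ∘ ≡.sym ] (SamePair-meets-endpoint xy≡uv p-end)

    -- The spare cop shadows Robber, so it already occupies an endpoint when he first reaches one.
    unguarded : ∀ {x C D} → H.CopsWin x C → C ⊆ D → ∣ D ∣ ≤ suc j → F.CopsWin x D
    unguarded {x} (H.win C' mv ∣C'∣≤j next) C⊆D ∣D∣≤1+j
      with follow x mv ∣C'∣≤j C⊆D (x∈p∪⁅x⁆ _ x) ∣D∣≤1+j
    ... | moveOnto D' mv' cover ∣D'∣≤1+j = F.win D' mv' ∣D'∣≤1+j respond
      where
      C'⊆D' : C' ⊆ D'
      C'⊆D' = cover ∘ p⊆p∪q _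
      x∈D' : x ∈ D'
      x∈D' = cover (x∈p∪⁅x⁆ _ x)
      respond : ∀ y → Adj G x y → y ∉ D' → F.CopsWin y D'
      respond y xy y∉D' with SamePair? G u v x y | x ≟ u ⊎-dec x ≟ v
      ... | yes xy≡uv | _         =
        guarded x (SamePair⇒endpoint xy≡uv) x∈D' (x∈p∧y∉p⇒y≢x x∈D' y∉D') (win y) ⊥⊆ ∣D'∣≤1+j
      ... | no  xy≢uv | yes x-end =
        guarded x x-end x∈D' (x∈p∧y∉p⇒y≢x x∈D' y∉D')
          (next y (Adj-removeEdge⁺ G u v xy xy≢uv) (y∉D' ∘ C'⊆D')) C'⊆D' ∣D'∣≤1+j
      ... | no  xy≢uv | no  _     =
        unguarded (next y (Adj-removeEdge⁺ G u v xy xy≢uv) (y∉D' ∘ C'⊆D')) C'⊆D' ∣D'∣≤1+j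

  removeEdge-CopsWinGame : CopsWinGame G (suc j)
  removeEdge-CopsWinGame v₀ = unguarded (win v₀) ⊥⊆ (≤-trans (≤-reflexive (∣⊥∣≡0 (n G))) z≤n)

corollary1 : (k : ℕ) (F : Graph) → InFk k F → EntIs F (suc k)
corollary1 k F (ent>k , minors≤k) = copsWin , λ j j<1+k → ent>k j (≤-pred j<1+k)
  where
  copsWin : CopsWinGame F (suc k)
  copsWin with edge? F
  ... | no noEdge = contradiction (edgeless⇒CopsWinGame-0 F λ x y xy → noEdge (x , y , xy)) (ent>k 0 z≤n)
  ... | yes (u , v , uv)
    with minors≤k (removeEdge F u v) (single (delete-edge (removeEdge-isEdgeDeletion F u v uv)))
  ...   | j , j≤k , win = CopsWinGame-mono F (s≤s j≤k) (removeEdge-CopsWinGame F u v win)
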